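{- Let $\sigma_1,\sigma_2,\dots$ be a sequence of complex numbers such that $\sigma_n=(-1)^nP(n)$ for all $n\ge A$, where $A$ is some natural integer and $P(s)\in\mathbb C[s]$ is a polynomial. Then the formal power series $U(x,\sigma_1,\sigma_2,\dots)\in\mathbb C[[x]]$ is rational.
   Context: Integers $t_{i,j}(n)$ for $n\ge1$, $i,j\in\mathbb Z$: $t_{2,0}(1)=1$ and $t_{i,j}(1)=0$ otherwise; for $n\ge2$, $t_{i,j}(n)=(i-2)t_{i-1,j}(n-1)+t_{i-1,j-1}(n-1)+(i-3)t_{i-2,j}(n-1)$ (nonzero only for $n+1\le i\le 2n$, $0\le j\le 2n-i$). $U(x,\sigma_1,\sigma_2,\dots)=1-\sum_{n\ge1}x^n\sum_{i=n+1}^{2n}\sigma_i\sum_{j=0}^{2n-i}t_{i,j}(n)(-\sigma_1)^j$; the coefficient of $x^n$ involves only $\sigma_1,\dots,\sigma_{2n}$, so it can be specialized at any complex sequence. -}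

module Defs where

open import Level using (Level; _⊔_) renaming (suc to lsuc)
open import Data.Nat as ℕ using (ℕ; zero; suc; _≤_; _∸_)
open import Data.Integer as ℤ using (ℤ; +_; -[1+_])
open import Data.List using (List; []; _∷_; _++_; [_]; length)
open import Data.Product using (Σ; ∃; _×_; _,_)
open import Data.Bool using (if_then_else_)
open import Relation.Nullary using (¬_)
open import Relation.Nullary.Decidable using (⌊_⌋)
open import Algebra.Bundles using (CommutativeRing)

-- The integers t_{i,j}(n)  (n ≥ 1; t 0 is an unused junk value 0)

t : ℕ → ℤ → ℤ → ℤ
t zero i j = + 0
t (suc zero) i j = if ⌊ i ℤ.≟ + 2 ⌋ then (if ⌊ j ℤ.≟ + 0 ⌋ then + 1 else + 0) else + 0
t (suc (suc n)) i j =
  ((i ℤ.- + 2) ℤ.* t (suc n) (i ℤ.- + 1) j)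
  ℤ.+ t (suc n) (i ℤ.- + 1) (j ℤ.- + 1)
  ℤ.+ ((i ℤ.- + 3) ℤ.* t (suc n) (i ℤ.- + 2) j)

record Field (c ℓ : Level) : Set (lsuc (c ⊔ ℓ)) where
  field
    commutativeRing : CommutativeRing c ℓ
  open CommutativeRing commutativeRing public
  field
    1≉0     : ¬ (1# ≈ 0#)
    inverse : ∀ x → ¬ (x ≈ 0#) → ∃ λ y → (x * y) ≈ 1#

module FieldOps {c ℓ : Level} (F : Field c ℓ) where
  open Field F

  ℕ→F : ℕ → Carrier
  ℕ→F zero = 0#
  ℕ→F (suc n) = 1# + ℕ→F n

  ℤ→F : ℤ → Carrier
  ℤ→F (+ n) = ℕ→F n
  ℤ→F -[1+ n ] = - ℕ→F (suc n)

  infixr 8 _^_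
  _^_ : Carrier → ℕ → Carrier
  x ^ zero = 1#
  x ^ suc n = x * (x ^ n)

  -- polynomials as coefficient lists c₀ ∷ c₁ ∷ … (lowest degree first)
  Poly : Set c
  Poly = List Carrier

  eval : Poly → Carrier → Carrier
  eval [] x = 0#
  eval (a ∷ as) x = a + x * eval as x

  coeff : Poly → ℕ → Carrier
  coeff [] k = 0#
  coeff (a ∷ as) zero = a
  coeff (a ∷ as) (suc k) = coeff as k

  sumBelow : ℕ → (ℕ → Carrier) → Carrier
  sumBelow zero f = 0#
  sumBelow (suc m) f = sumBelow m f + f m

  -- Σ_{k=a}^{b} f k   (empty if b < a)
  sumFromTo : ℕ → ℕ → (ℕ → Carrier) → Carrier
  sumFromTo a b f = sumBelow (suc b ∸ a) (λ k → f (a ℕ.+ k))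

  CharacteristicZero : Set ℓ
  CharacteristicZero = ∀ n → ¬ (ℕ→F (suc n) ≈ 0#)

  -- every monic polynomial c₀ + … + c_{d-1} x^{d-1} + x^d of degree d ≥ 1 has a root
  AlgebraicallyClosed : Set (c ⊔ ℓ)
  AlgebraicallyClosed = ∀ (cs : Poly) → 1 ≤ length cs → ∃ λ x → eval (cs ++ [ 1# ]) x ≈ 0#

  PowerSeries : Set c
  PowerSeries = ℕ → Carrier

  polyTimes : Poly → PowerSeries → PowerSeries
  polyTimes R f m = sumBelow (suc m) (λ k → coeff R k * f (m ∸ k))

  -- f is rational: f = Q / R for polynomials Q, R with R(0) = 1,
  -- i.e. R · f = Q in F[[x]]
  IsRational : PowerSeries → Set (c ⊔ ℓ)
  IsRational f = Σ Poly λ Q → Σ Poly λ R →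
    (coeff R 0 ≈ 1#) × (∀ m → polyTimes R f m ≈ coeff Q m)

  -- U(x, σ₁, σ₂, …); σ is indexed by ℕ, σ 0 is never used
  U : (ℕ → Carrier) → PowerSeries
  U σ zero = 1#
  U σ (suc n') = - sumFromTo (suc n) (2 ℕ.* n) (λ i →
      σ i * sumFromTo 0 (2 ℕ.* n ∸ i) (λ j →
        ℤ→F (t n (+ i) (+ j)) * ((- σ 1) ^ j)))
    where n = suc n'

  EventuallyAltPoly : (ℕ → Carrier) → Set (c ⊔ ℓ)
  EventuallyAltPoly σ = ∃ λ (A : ℕ) → ∃ λ (P : Poly) →
    ∀ n → 1 ≤ n → A ≤ n → σ n ≈ (((- 1#) ^ n) * eval P (ℕ→F n))

module Submission where

-- Write -U_n = Σ_i σ_i w_{n,i}(s) with s = -σ_1 and w_{n,i}(s) = Σ_j t_{i,j}(n) s^j. The recursion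
-- for t becomes w_{n+1,i+2} = (i + s) w_{n,i+1} + (i - 1) w_{n,i}, so, transposing, the functional
-- f ↦ Σ_i f_i w_{n,i} equals f ↦ (Φ^{n-1} f)_2 for a second-order difference operator Φ.
-- As w_{n,i} = 0 for i ≤ n, once n > A only the tail σ_i = (-1)^i P(i) matters, and conjugating Φ
-- by the signs (-1)^i gives an operator Ψ that maps polynomial functions of degree < D to themselves,
-- acting triangularly with diagonal entries d - s (d < D). Hence Π_{d<D} (Ψ - (d - s)) kills
-- k ↦ P(k), so the coefficients of U eventually satisfy a linear recurrence with constant
-- coefficients, which is to say that U is rational.

open import Defs
open import Level using (Level; _⊔_)
open import Data.Nat as ℕ using (ℕ; zero; suc; _∸_; z≤n; s≤s)
import Data.Nat.Properties as ℕP
open import Data.Nat.GeneralisedArithmetic using (iterate)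
open import Data.Integer as ℤ using (ℤ; +_; -[1+_]; +<+; -<+)
import Data.Integer.Properties as ℤP
open import Data.Integer.Base using (+-*-rawRing)
open import Data.Integer.Solver using (module +-*-Solver)
open import Data.List using ([]; _∷_; length; applyUpTo)
open import Data.List.Properties using (length-applyUpTo)
open import Data.Maybe using (Maybe; just; nothing)
open import Data.Product using (_,_)
open import Data.Sum using (_⊎_; inj₁; inj₂)
open import Data.Empty using (⊥-elim)
open import Relation.Nullary using (¬_; yes; no)
open import Relation.Binary.PropositionalEquality as ≡ using (_≡_)
open import Algebra.Solver.Ring.AlmostCommutativeRing
  using (_-Raw-AlmostCommutative⟶_; fromCommutativeRing)
import Algebra.Solver.Ring as RingSolver
import Algebra.Properties.Ring as RingProperties
import Algebra.Properties.Semiring.Mult as SemiringMult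
import Algebra.Properties.CommutativeSemigroup as CommSemigroupProperties

OffSupport : ℕ → ℤ → ℤ → Set
OffSupport m i j = (j ℤ.< + 0) ⊎ (i ℤ.< + suc (suc m)) ⊎ (+ (2 ℕ.+ m ℕ.* 2) ℤ.< i ℤ.+ j)

¬OffSupport-0-2-0 : ¬ OffSupport 0 (+ 2) (+ 0)
¬OffSupport-0-2-0 (inj₁ (+<+ ()))
¬OffSupport-0-2-0 (inj₂ (inj₁ (+<+ (s≤s (s≤s ())))))
¬OffSupport-0-2-0 (inj₂ (inj₂ (+<+ (s≤s (s≤s ())))))

module _ where
  open +-*-Solver

  private
    i-1+j : ∀ i j → (i ℤ.- + 1) ℤ.+ j ≡ (i ℤ.+ j) ℤ.+ -[1+ 0 ]
    i-1+j = solve 2 (λ i j → (i :- con (+ 1)) :+ j := (i :+ j) :+ con -[1+ 0 ]) ≡.refl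

    i-1+j-1 : ∀ i j → (i ℤ.- + 1) ℤ.+ (j ℤ.- + 1) ≡ (i ℤ.+ j) ℤ.+ -[1+ 1 ]
    i-1+j-1 = solve 2 (λ i j → (i :- con (+ 1)) :+ (j :- con (+ 1)) := (i :+ j) :+ con -[1+ 1 ]) ≡.refl

    i-2+j : ∀ i j → (i ℤ.- + 2) ℤ.+ j ≡ (i ℤ.+ j) ℤ.+ -[1+ 1 ]
    i-2+j = solve 2 (λ i j → (i :- con (+ 2)) :+ j := (i :+ j) :+ con -[1+ 1 ]) ≡.refl

  offSupport-i∸1 : ∀ m i j → OffSupport (suc m) i j → OffSupport m (i ℤ.- + 1) j
  offSupport-i∸1 m i j (inj₁ j<0) = inj₁ j<0
  offSupport-i∸1 m i j (inj₂ (inj₁ i<)) = inj₂ (inj₁ (ℤP.+-monoˡ-< -[1+ 0 ] i<))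
  offSupport-i∸1 m i j (inj₂ (inj₂ <i+j)) = inj₂ (inj₂ (≡.subst (_ ℤ.<_) (≡.sym (i-1+j i j))
    (ℤP.<-trans (+<+ (ℕP.n<1+n _)) (ℤP.+-monoˡ-< -[1+ 0 ] <i+j))))

  offSupport-i∸1-j∸1 : ∀ m i j → OffSupport (suc m) i j → OffSupport m (i ℤ.- + 1) (j ℤ.- + 1)
  offSupport-i∸1-j∸1 m i j (inj₁ j<0) = inj₁ (ℤP.<-trans (ℤP.+-monoˡ-< -[1+ 0 ] j<0) -<+)
  offSupport-i∸1-j∸1 m i j (inj₂ (inj₁ i<)) = inj₂ (inj₁ (ℤP.+-monoˡ-< -[1+ 0 ] i<))
  offSupport-i∸1-j∸1 m i j (inj₂ (inj₂ <i+j)) = inj₂ (inj₂ (≡.subst (_ ℤ.<_) (≡.sym (i-1+j-1 i j))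
    (ℤP.+-monoˡ-< -[1+ 1 ] <i+j)))

  offSupport-i∸2 : ∀ m i j → OffSupport (suc m) i j → OffSupport m (i ℤ.- + 2) j
  offSupport-i∸2 m i j (inj₁ j<0) = inj₁ j<0
  offSupport-i∸2 m i j (inj₂ (inj₁ i<)) =
    inj₂ (inj₁ (ℤP.<-trans (ℤP.+-monoˡ-< -[1+ 1 ] i<) (+<+ (ℕP.n<1+n _))))
  offSupport-i∸2 m i j (inj₂ (inj₂ <i+j)) = inj₂ (inj₂ (≡.subst (_ ℤ.<_) (≡.sym (i-2+j i j))
    (ℤP.+-monoˡ-< -[1+ 1 ] <i+j)))

t-off-support : ∀ m i j → OffSupport m i j → t (suc m) i j ≡ + 0
t-off-support zero i j off with i ℤ.≟ + 2 | j ℤ.≟ + 0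
... | no _      | _        = ≡.refl
... | yes _     | no _     = ≡.refl
... | yes ≡.refl | yes ≡.refl = ⊥-elim (¬OffSupport-0-2-0 off)
t-off-support (suc m) i j off
  rewrite t-off-support m (i ℤ.- + 1) j (offSupport-i∸1 m i j off)
        | t-off-support m (i ℤ.- + 1) (j ℤ.- + 1) (offSupport-i∸1-j∸1 m i j off)
        | t-off-support m (i ℤ.- + 2) j (offSupport-i∸2 m i j off)
        | ℤP.*-zeroʳ (i ℤ.- + 2) | ℤP.*-zeroʳ (i ℤ.- + 3) = ≡.refl

module Rationality {c ℓ : Level} (F : Field c ℓ) where
  open Field F
  open FieldOps F
  open RingProperties ring using (-0#≈0#; -‿involutive; -‿+-comm; -‿distribˡ-*; -‿distribʳ-*)
  open SemiringMult semiring using (_×_; ×-homo-+; ×1-homo-*)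
  open CommSemigroupProperties *-commutativeSemigroup using (x∙yz≈y∙xz)
  open import Relation.Binary.Reasoning.Setoid setoid

  ℕ→F≡×1# : ∀ n → ℕ→F n ≡ n × 1#
  ℕ→F≡×1# zero = ≡.refl
  ℕ→F≡×1# (suc n) = ≡.cong (λ x → 1# + x) (ℕ→F≡×1# n)

  ℕ→F-homo-+ : ∀ m n → ℕ→F (m ℕ.+ n) ≈ ℕ→F m + ℕ→F n
  ℕ→F-homo-+ m n rewrite ℕ→F≡×1# (m ℕ.+ n) | ℕ→F≡×1# m | ℕ→F≡×1# n = ×-homo-+ 1# m n

  ℕ→F-homo-* : ∀ m n → ℕ→F (m ℕ.* n) ≈ ℕ→F m * ℕ→F n
  ℕ→F-homo-* m n rewrite ℕ→F≡×1# (m ℕ.* n) | ℕ→F≡×1# m | ℕ→F≡×1# n = ×1-homo-* m n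

  [a+b]-[a+d]≈b-d : ∀ a b d → (a + b) - (a + d) ≈ b - d
  [a+b]-[a+d]≈b-d a b d = begin
    (a + b) + - (a + d)     ≈⟨ +-congˡ (sym (-‿+-comm a d)) ⟩
    (a + b) + (- a + - d)   ≈⟨ +-assoc _ _ _ ⟩
    a + (b + (- a + - d))   ≈⟨ +-congˡ (sym (+-assoc _ _ _)) ⟩
    a + ((b + - a) + - d)   ≈⟨ +-congˡ (+-congʳ (+-comm _ _)) ⟩
    a + ((- a + b) + - d)   ≈⟨ +-congˡ (+-assoc _ _ _) ⟩
    a + (- a + (b + - d))   ≈⟨ sym (+-assoc _ _ _) ⟩
    (a + - a) + (b + - d)   ≈⟨ +-congʳ (-‿inverseʳ a) ⟩
    0# + (b + - d)          ≈⟨ +-identityˡ _ ⟩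
    b - d                   ∎

  ℤ→F-homo-⊖ : ∀ m n → ℤ→F (m ℤ.⊖ n) ≈ ℕ→F m - ℕ→F n
  ℤ→F-homo-⊖ m zero = sym (trans (+-congˡ -0#≈0#) (+-identityʳ _))
  ℤ→F-homo-⊖ zero (suc n) = sym (+-identityˡ _)
  ℤ→F-homo-⊖ (suc m) (suc n) = begin
    ℤ→F (suc m ℤ.⊖ suc n)       ≡⟨ ≡.cong ℤ→F (ℤP.[1+m]⊖[1+n]≡m⊖n m n) ⟩
    ℤ→F (m ℤ.⊖ n)               ≈⟨ ℤ→F-homo-⊖ m n ⟩
    ℕ→F m - ℕ→F n               ≈⟨ [a+b]-[a+d]≈b-d 1# _ _ ⟨
    ℕ→F (suc m) - ℕ→F (suc n)   ∎

  ℤ→F-homo-neg : ∀ i → ℤ→F (ℤ.- i) ≈ - ℤ→F i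
  ℤ→F-homo-neg (+ zero) = sym -0#≈0#
  ℤ→F-homo-neg (+ suc n) = refl
  ℤ→F-homo-neg -[1+ n ] = sym (-‿involutive _)

  ℤ→F-homo-+ : ∀ i j → ℤ→F (i ℤ.+ j) ≈ ℤ→F i + ℤ→F j
  ℤ→F-homo-+ (+ m) (+ n) = ℕ→F-homo-+ m n
  ℤ→F-homo-+ (+ m) -[1+ n ] = ℤ→F-homo-⊖ m (suc n)
  ℤ→F-homo-+ -[1+ m ] (+ n) = trans (ℤ→F-homo-⊖ n (suc m)) (+-comm _ _)
  ℤ→F-homo-+ -[1+ m ] -[1+ n ] = begin
    - ℕ→F (suc (suc (m ℕ.+ n)))            ≡⟨ ≡.cong (λ k → - ℕ→F (suc k)) (ℕP.+-suc m n) ⟨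
    - ℕ→F (suc m ℕ.+ suc n)                ≈⟨ -‿cong (ℕ→F-homo-+ (suc m) (suc n)) ⟩
    - (ℕ→F (suc m) + ℕ→F (suc n))          ≈⟨ -‿+-comm _ _ ⟨
    - ℕ→F (suc m) + - ℕ→F (suc n)          ∎

  ℤ→F-homo-*-pos : ∀ m j → ℤ→F (+ m ℤ.* j) ≈ ℕ→F m * ℤ→F j
  ℤ→F-homo-*-pos m (+ n) = trans (reflexive (≡.cong ℤ→F (≡.sym (ℤP.pos-* m n)))) (ℕ→F-homo-* m n)
  ℤ→F-homo-*-pos m -[1+ n ] = begin
    ℤ→F (+ m ℤ.* ℤ.- + suc n)    ≡⟨ ≡.cong ℤ→F (ℤP.neg-distribʳ-* (+ m) (+ suc n)) ⟨
    ℤ→F (ℤ.- (+ m ℤ.* + suc n))  ≈⟨ ℤ→F-homo-neg (+ m ℤ.* + suc n) ⟩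
    - ℤ→F (+ m ℤ.* + suc n)      ≈⟨ -‿cong (ℤ→F-homo-*-pos m (+ suc n)) ⟩
    - (ℕ→F m * ℕ→F (suc n))      ≈⟨ -‿distribʳ-* _ _ ⟩
    ℕ→F m * - ℕ→F (suc n)        ∎

  ℤ→F-homo-* : ∀ i j → ℤ→F (i ℤ.* j) ≈ ℤ→F i * ℤ→F j
  ℤ→F-homo-* (+ m) j = ℤ→F-homo-*-pos m j
  ℤ→F-homo-* -[1+ m ] j = begin
    ℤ→F (ℤ.- + suc m ℤ.* j)      ≡⟨ ≡.cong ℤ→F (ℤP.neg-distribˡ-* (+ suc m) j) ⟨
    ℤ→F (ℤ.- (+ suc m ℤ.* j))    ≈⟨ ℤ→F-homo-neg (+ suc m ℤ.* j) ⟩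
    - ℤ→F (+ suc m ℤ.* j)        ≈⟨ -‿cong (ℤ→F-homo-*-pos (suc m) j) ⟩
    - (ℕ→F (suc m) * ℤ→F j)      ≈⟨ -‿distribˡ-* _ _ ⟩
    - ℕ→F (suc m) * ℤ→F j        ∎

  -- The solver's constant `con (+ 1)` must denote 1# itself, whereas ℤ→F (+ 1) is 1# + 0#.
  ℕ→F′ : ℕ → Carrier
  ℕ→F′ zero = 0#
  ℕ→F′ (suc zero) = 1#
  ℕ→F′ (suc (suc n)) = 1# + ℕ→F′ (suc n)

  ℤ→F′ : ℤ → Carrier
  ℤ→F′ (+ n) = ℕ→F′ n
  ℤ→F′ -[1+ n ] = - ℕ→F′ (suc n)

  ℕ→F′≈ℕ→F : ∀ n → ℕ→F′ n ≈ ℕ→F n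
  ℕ→F′≈ℕ→F zero = refl
  ℕ→F′≈ℕ→F (suc zero) = sym (+-identityʳ _)
  ℕ→F′≈ℕ→F (suc (suc n)) = +-congˡ (ℕ→F′≈ℕ→F (suc n))

  ℤ→F′≈ℤ→F : ∀ i → ℤ→F′ i ≈ ℤ→F i
  ℤ→F′≈ℤ→F (+ n) = ℕ→F′≈ℕ→F n
  ℤ→F′≈ℤ→F -[1+ n ] = -‿cong (ℕ→F′≈ℕ→F (suc n))

  ℤ-coefficients : +-*-rawRing -Raw-AlmostCommutative⟶ fromCommutativeRing commutativeRing
  ℤ-coefficients = record
    { ⟦_⟧ = ℤ→F′
    ; +-homo = λ i j → via (i ℤ.+ j) (ℤ→F-homo-+ i j) (+-cong (ℤ→F′≈ℤ→F i) (ℤ→F′≈ℤ→F j))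
    ; *-homo = λ i j → via (i ℤ.* j) (ℤ→F-homo-* i j) (*-cong (ℤ→F′≈ℤ→F i) (ℤ→F′≈ℤ→F j))
    ; -‿homo = λ i → via (ℤ.- i) (ℤ→F-homo-neg i) (-‿cong (ℤ→F′≈ℤ→F i))
    ; 0-homo = refl
    ; 1-homo = refl
    }
    where
    via : ∀ i {x x′} → ℤ→F i ≈ x → x′ ≈ x → ℤ→F′ i ≈ x′
    via i hom cong′ = trans (ℤ→F′≈ℤ→F i) (trans hom (sym cong′))

  ℤ→F′-≟ : ∀ i j → Maybe (ℤ→F′ i ≈ ℤ→F′ j)
  ℤ→F′-≟ i j with i ℤ.≟ j
  ... | yes ≡.refl = just refl
  ... | no _ = nothing

  open RingSolver +-*-rawRing (fromCommutativeRing commutativeRing) ℤ-coefficients ℤ→F′-≟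
    using (solve; _:=_; con; _:+_; _:-_; _:*_; :-_)

  sumBelow-cong : ∀ n {f g : ℕ → Carrier} → (∀ k → k ℕ.< n → f k ≈ g k) → sumBelow n f ≈ sumBelow n g
  sumBelow-cong zero f≈g = refl
  sumBelow-cong (suc n) f≈g = +-cong (sumBelow-cong n (λ k k<n → f≈g k (ℕP.m<n⇒m<1+n k<n))) (f≈g n ℕP.≤-refl)

  sumBelow-zero : ∀ n {f : ℕ → Carrier} → (∀ k → k ℕ.< n → f k ≈ 0#) → sumBelow n f ≈ 0#
  sumBelow-zero zero f≈0 = refl
  sumBelow-zero (suc n) f≈0 =
    trans (+-cong (sumBelow-zero n (λ k k<n → f≈0 k (ℕP.m<n⇒m<1+n k<n))) (f≈0 n ℕP.≤-refl)) (+-identityʳ _)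

  sumBelow-+ : ∀ n (f g : ℕ → Carrier) → sumBelow n (λ k → f k + g k) ≈ sumBelow n f + sumBelow n g
  sumBelow-+ zero f g = sym (+-identityʳ _)
  sumBelow-+ (suc n) f g = trans (+-congʳ (sumBelow-+ n f g))
    (solve 4 (λ a b x y → (a :+ b) :+ (x :+ y) := (a :+ x) :+ (b :+ y)) refl _ _ _ _)

  sumBelow-*ˡ : ∀ n a (f : ℕ → Carrier) → sumBelow n (λ k → a * f k) ≈ a * sumBelow n f
  sumBelow-*ˡ zero a f = sym (zeroʳ _)
  sumBelow-*ˡ (suc n) a f = trans (+-congʳ (sumBelow-*ˡ n a f)) (sym (distribˡ _ _ _))

  sumBelow-suc : ∀ n (f : ℕ → Carrier) → sumBelow (suc n) f ≈ f 0 + sumBelow n (λ k → f (suc k))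
  sumBelow-suc zero f = trans (+-identityˡ _) (sym (+-identityʳ _))
  sumBelow-suc (suc n) f = trans (+-congʳ (sumBelow-suc n f)) (+-assoc _ _ _)

  sumBelow-+-length : ∀ a b (f : ℕ → Carrier) →
    sumBelow (a ℕ.+ b) f ≈ sumBelow a f + sumBelow b (λ k → f (a ℕ.+ k))
  sumBelow-+-length a zero f rewrite ℕP.+-identityʳ a = sym (+-identityʳ _)
  sumBelow-+-length a (suc b) f rewrite ℕP.+-suc a b =
    trans (+-congʳ (sumBelow-+-length a b f)) (+-assoc _ _ _)

  sumBelow-extend : ∀ {b B} (f : ℕ → Carrier) → b ℕ.≤ B → (∀ k → b ℕ.≤ k → f k ≈ 0#) →
    sumBelow B f ≈ sumBelow b f
  sumBelow-extend {b} {B} f b≤B f≈0 = begin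
    sumBelow B f                                        ≡⟨ ≡.cong (λ n → sumBelow n f) (ℕP.m+[n∸m]≡n b≤B) ⟨
    sumBelow (b ℕ.+ (B ∸ b)) f                          ≈⟨ sumBelow-+-length b (B ∸ b) f ⟩
    sumBelow b f + sumBelow (B ∸ b) (λ k → f (b ℕ.+ k)) ≈⟨ +-congˡ (sumBelow-zero (B ∸ b) tail≈0) ⟩
    sumBelow b f + 0#                                   ≈⟨ +-identityʳ _ ⟩
    sumBelow b f                                        ∎
    where
    tail≈0 : ∀ k → k ℕ.< B ∸ b → f (b ℕ.+ k) ≈ 0#
    tail≈0 k _ = f≈0 (b ℕ.+ k) (ℕP.m≤m+n b k)

  sumBelow-reindex-suc : ∀ n (f : ℕ → Carrier) → f 0 ≈ 0# → f n ≈ 0# →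
    sumBelow n (λ k → f (suc k)) ≈ sumBelow n f
  sumBelow-reindex-suc n f f₀≈0 fₙ≈0 = begin
    sumBelow n (λ k → f (suc k))        ≈⟨ +-identityˡ _ ⟨
    0# + sumBelow n (λ k → f (suc k))   ≈⟨ +-congʳ f₀≈0 ⟨
    f 0 + sumBelow n (λ k → f (suc k))  ≈⟨ sumBelow-suc n f ⟨
    sumBelow n f + f n                  ≈⟨ +-congˡ fₙ≈0 ⟩
    sumBelow n f + 0#                   ≈⟨ +-identityʳ _ ⟩
    sumBelow n f                        ∎

  sumFromTo-as-sumBelow : ∀ {a} b (f : ℕ → Carrier) → a ℕ.≤ suc b → (∀ k → k ℕ.< a → f k ≈ 0#) →
    sumFromTo a b f ≈ sumBelow (suc b) f
  sumFromTo-as-sumBelow {a} b f a≤ f≈0 = begin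
    sumFromTo a b f                 ≈⟨ +-identityˡ _ ⟨
    0# + sumFromTo a b f            ≈⟨ +-congʳ (sumBelow-zero a f≈0) ⟨
    sumBelow a f + sumFromTo a b f  ≈⟨ sumBelow-+-length a (suc b ∸ a) f ⟨
    sumBelow (a ℕ.+ (suc b ∸ a)) f  ≡⟨ ≡.cong (λ n → sumBelow n f) (ℕP.m+[n∸m]≡n a≤) ⟩
    sumBelow (suc b) f              ∎

  addPoly : Poly → Poly → Poly
  addPoly [] Q = Q
  addPoly (a ∷ P) [] = a ∷ P
  addPoly (a ∷ P) (b ∷ Q) = (a + b) ∷ addPoly P Q

  scalePoly : Carrier → Poly → Poly
  scalePoly d [] = []
  scalePoly d (a ∷ P) = (d * a) ∷ scalePoly d P

  coeff-addPoly : ∀ P Q k → coeff (addPoly P Q) k ≈ coeff P k + coeff Q k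
  coeff-addPoly [] Q k = sym (+-identityˡ _)
  coeff-addPoly (a ∷ P) [] zero = sym (+-identityʳ _)
  coeff-addPoly (a ∷ P) [] (suc k) = sym (+-identityʳ _)
  coeff-addPoly (a ∷ P) (b ∷ Q) zero = refl
  coeff-addPoly (a ∷ P) (b ∷ Q) (suc k) = coeff-addPoly P Q k

  coeff-scalePoly : ∀ d P k → coeff (scalePoly d P) k ≈ d * coeff P k
  coeff-scalePoly d [] k = sym (zeroʳ _)
  coeff-scalePoly d (a ∷ P) zero = refl
  coeff-scalePoly d (a ∷ P) (suc k) = coeff-scalePoly d P k

  coeff-≥length : ∀ P {k} → length P ℕ.≤ k → coeff P k ≡ 0#
  coeff-≥length [] _ = ≡.refl
  coeff-≥length (a ∷ P) (s≤s le) = coeff-≥length P le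

  coeff-applyUpTo : ∀ (f : ℕ → Carrier) n {k} → k ℕ.< n → coeff (applyUpTo f n) k ≡ f k
  coeff-applyUpTo f (suc n) {zero} _ = ≡.refl
  coeff-applyUpTo f (suc n) {suc k} (s≤s k<n) = coeff-applyUpTo (λ i → f (suc i)) n k<n

  polyTimes-local : ∀ P m {a b : PowerSeries} → (∀ k → k ℕ.< length P → a (m ∸ k) ≈ b (m ∸ k)) →
    polyTimes P a m ≈ polyTimes P b m
  polyTimes-local P m {a} {b} a≈b = sumBelow-cong (suc m) termwise
    where
    termwise : ∀ k → k ℕ.< suc m → coeff P k * a (m ∸ k) ≈ coeff P k * b (m ∸ k)
    termwise k _ with length P ℕP.≤? k
    ... | yes P≤k rewrite coeff-≥length P P≤k = trans (zeroˡ _) (sym (zeroˡ _))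
    ... | no  P≰k = *-congˡ (a≈b k (ℕP.≰⇒> P≰k))

  polyTimes-addPoly : ∀ P Q (a : PowerSeries) m → polyTimes (addPoly P Q) a m ≈ polyTimes P a m + polyTimes Q a m
  polyTimes-addPoly P Q a m =
    trans (sumBelow-cong (suc m) (λ k _ → trans (*-congʳ (coeff-addPoly P Q k)) (distribʳ _ _ _)))
          (sumBelow-+ (suc m) _ _)

  polyTimes-scalePoly : ∀ d P (a : PowerSeries) m → polyTimes (scalePoly d P) a m ≈ d * polyTimes P a m
  polyTimes-scalePoly d P a m =
    trans (sumBelow-cong (suc m) (λ k _ → trans (*-congʳ (coeff-scalePoly d P k)) (*-assoc _ _ _)))
          (sumBelow-*ˡ (suc m) d _)

  polyTimes-0∷ : ∀ P (a : PowerSeries) m → polyTimes (0# ∷ P) a (suc m) ≈ polyTimes P a m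
  polyTimes-0∷ P a m =
    trans (sumBelow-suc (suc m) _) (trans (+-congʳ (zeroˡ _)) (+-identityˡ _))

  polyTimes-suc : ∀ P (a : PowerSeries) m →
    polyTimes P a (suc m) ≈ polyTimes P (λ k → a (suc k)) m + coeff P (suc m) * a 0
  polyTimes-suc P a m = +-cong
    (sumBelow-cong (suc m) (λ k k≤m → *-congˡ (reflexive (≡.cong a (ℕP.+-∸-assoc 1 (ℕP.≤-pred k≤m))))))
    (*-congˡ (reflexive (≡.cong a (ℕP.n∸n≡0 m))))

  polyTimes-+ : ∀ P (a b : PowerSeries) m → polyTimes P (λ k → a k + b k) m ≈ polyTimes P a m + polyTimes P b m
  polyTimes-+ P a b m = trans (sumBelow-cong (suc m) (λ k _ → distribˡ _ _ _)) (sumBelow-+ (suc m) _ _)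

  polyTimes-*ˡ : ∀ P d (a : PowerSeries) m → polyTimes P (λ k → d * a k) m ≈ d * polyTimes P a m
  polyTimes-*ˡ P d a m = trans (sumBelow-cong (suc m) (λ k _ → x∙yz≈y∙xz _ _ _)) (sumBelow-*ˡ (suc m) d _)

  -- R · a is a polynomial: a satisfies a linear recurrence with constant coefficients.
  record EventuallyAnnihilated (a : PowerSeries) : Set (c ⊔ ℓ) where
    constructor annihilated
    field
      annihilator   : Poly
      annihilator₀  : coeff annihilator 0 ≈ 1#
      threshold     : ℕ
      annihilates   : ∀ m → threshold ℕ.≤ m → polyTimes annihilator a m ≈ 0#

  zero-annihilated : EventuallyAnnihilated (λ _ → 0#)
  zero-annihilated = annihilated (1# ∷ []) refl 0 λ m _ → sumBelow-zero (suc m) (λ k _ → zeroʳ _)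

  annihilated⇒rational : ∀ {a} → EventuallyAnnihilated a → IsRational a
  annihilated⇒rational {a} (annihilated R R₀≈1 N Ra≈0) = applyUpTo (polyTimes R a) N , R , R₀≈1 , Ra≈Q
    where
    Ra≈Q : ∀ m → polyTimes R a m ≈ coeff (applyUpTo (polyTimes R a) N) m
    Ra≈Q m with m ℕP.<? N
    ... | yes m<N = reflexive (≡.sym (coeff-applyUpTo (polyTimes R a) N m<N))
    ... | no  m≮N =
      trans (Ra≈0 m (ℕP.≮⇒≥ m≮N)) (reflexive (≡.sym (coeff-≥length (applyUpTo (polyTimes R a) N) Q≤m)))
      where
      Q≤m = ℕP.≤-trans (ℕP.≤-reflexive (length-applyUpTo (polyTimes R a) N)) (ℕP.≮⇒≥ m≮N)

  annihilated-eventually-cong : ∀ A {a b : PowerSeries} → (∀ m → A ℕ.≤ m → a m ≈ b m) →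
    EventuallyAnnihilated a → EventuallyAnnihilated b
  annihilated-eventually-cong A {a} {b} a≈b (annihilated R R₀≈1 N Ra≈0) =
    annihilated R R₀≈1 (N ℕ.+ (A ℕ.+ length R)) Rb≈0
    where
    Rb≈0 : ∀ m → N ℕ.+ (A ℕ.+ length R) ℕ.≤ m → polyTimes R b m ≈ 0#
    Rb≈0 m le = trans (sym (polyTimes-local R m {a} {b} (λ k k<R → a≈b (m ∸ k) (A≤m∸k k k<R))))
                      (Ra≈0 m (ℕP.≤-trans (ℕP.m≤m+n N _) le))
      where
      A≤m∸k : ∀ k → k ℕ.< length R → A ℕ.≤ m ∸ k
      A≤m∸k k k<R = ℕP.m+n≤o⇒m≤o∸n A
        (ℕP.≤-trans (ℕP.+-monoʳ-≤ A (ℕP.<⇒≤ k<R)) (ℕP.≤-trans (ℕP.m≤n+m _ N) le))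

  annihilated-*ˡ : ∀ d {a : PowerSeries} → EventuallyAnnihilated a → EventuallyAnnihilated (λ m → d * a m)
  annihilated-*ˡ d {a} (annihilated R R₀≈1 N Ra≈0) = annihilated R R₀≈1 N λ m N≤m →
    trans (polyTimes-*ˡ R d a m) (trans (*-congˡ (Ra≈0 m N≤m)) (zeroʳ d))

  annihilated-tail : ∀ {a : PowerSeries} → EventuallyAnnihilated (λ m → a (suc m)) → EventuallyAnnihilated a
  annihilated-tail {a} (annihilated R R₀≈1 N Ra≈0) = annihilated R R₀≈1 (suc (N ℕ.+ length R)) Ra≈0′
    where
    Ra≈0′ : ∀ m → suc (N ℕ.+ length R) ℕ.≤ m → polyTimes R a m ≈ 0#
    Ra≈0′ (suc m) (s≤s le) = begin
      polyTimes R a (suc m)                                    ≈⟨ polyTimes-suc R a m ⟩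
      polyTimes R (λ k → a (suc k)) m + coeff R (suc m) * a 0  ≈⟨ +-cong (Ra≈0 m N≤m) (*-congʳ (reflexive Rₘ₊₁≡0)) ⟩
      0# + 0# * a 0                                            ≈⟨ trans (+-identityˡ _) (zeroˡ _) ⟩
      0#                                                       ∎
      where
      N≤m = ℕP.≤-trans (ℕP.m≤m+n N _) le
      Rₘ₊₁≡0 = coeff-≥length R (ℕP.m≤n⇒m≤1+n (ℕP.≤-trans (ℕP.m≤n+m _ N) le))

  -- Multiplying the annihilator by 1 + d x absorbs the first-order factor.
  annihilated-step : ∀ d {a : PowerSeries} →
    EventuallyAnnihilated (λ m → a (suc m) + d * a m) → EventuallyAnnihilated a
  annihilated-step d {a} (annihilated R R₀≈1 N Ra′≈0) = annihilated R′ R′₀≈1 (suc (N ℕ.+ length R)) R′a≈0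
    where
    R′ : Poly
    R′ = addPoly R (0# ∷ scalePoly d R)

    R′₀≈1 : coeff R′ 0 ≈ 1#
    R′₀≈1 = trans (coeff-addPoly R (0# ∷ scalePoly d R) 0) (trans (+-identityʳ _) R₀≈1)

    R′a≈0 : ∀ m → suc (N ℕ.+ length R) ℕ.≤ m → polyTimes R′ a m ≈ 0#
    R′a≈0 (suc m) (s≤s le) = begin
      polyTimes R′ a (suc m)
        ≈⟨ polyTimes-addPoly R _ a (suc m) ⟩
      polyTimes R a (suc m) + polyTimes (0# ∷ scalePoly d R) a (suc m)
        ≈⟨ +-cong (polyTimes-suc R a m) (trans (polyTimes-0∷ _ a m) (polyTimes-scalePoly d R a m)) ⟩
      (polyTimes R (λ k → a (suc k)) m + coeff R (suc m) * a 0) + d * polyTimes R a m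
        ≈⟨ solve 3 (λ x y z → (x :+ y) :+ z := (x :+ z) :+ y) refl _ _ _ ⟩
      (polyTimes R (λ k → a (suc k)) m + d * polyTimes R a m) + coeff R (suc m) * a 0
        ≈⟨ +-congʳ (sym (trans (polyTimes-+ R (λ k → a (suc k)) (λ k → d * a k) m)
                               (+-congˡ (polyTimes-*ˡ R d a m)))) ⟩
      polyTimes R (λ k → a (suc k) + d * a k) m + coeff R (suc m) * a 0
        ≈⟨ +-cong (Ra′≈0 m N≤m) (*-congʳ (reflexive Rₘ₊₁≡0)) ⟩
      0# + 0# * a 0
        ≈⟨ trans (+-identityˡ _) (zeroˡ _) ⟩
      0# ∎
      where
      N≤m = ℕP.≤-trans (ℕP.m≤m+n N _) le
      Rₘ₊₁≡0 = coeff-≥length R (ℕP.m≤n⇒m≤1+n (ℕP.≤-trans (ℕP.m≤n+m _ N) le))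

  Δ : (ℕ → Carrier) → ℕ → Carrier
  Δ h k = h (suc k) - h k

  DegreeBelow : ℕ → (ℕ → Carrier) → Set ℓ
  DegreeBelow zero h = ∀ k → h k ≈ 0#
  DegreeBelow (suc D) h = DegreeBelow D (Δ h)

  degreeBelow-cong : ∀ D {h g : ℕ → Carrier} → (∀ k → h k ≈ g k) → DegreeBelow D h → DegreeBelow D g
  degreeBelow-cong zero h≈g h≈0 k = trans (sym (h≈g k)) (h≈0 k)
  degreeBelow-cong (suc D) h≈g = degreeBelow-cong D (λ k → +-cong (h≈g (suc k)) (-‿cong (h≈g k)))

  degreeBelow-+ : ∀ D {h g : ℕ → Carrier} → DegreeBelow D h → DegreeBelow D g → DegreeBelow D (λ k → h k + g k)
  degreeBelow-+ zero dh dg k = trans (+-cong (dh k) (dg k)) (+-identityʳ _)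
  degreeBelow-+ (suc D) {h} {g} dh dg = degreeBelow-cong D
    (λ k → solve 4 (λ a₁ a₀ b₁ b₀ → (a₁ :- a₀) :+ (b₁ :- b₀) := (a₁ :+ b₁) :- (a₀ :+ b₀)) refl
              (h (suc k)) (h k) (g (suc k)) (g k))
    (degreeBelow-+ D dh dg)

  degreeBelow-suc : ∀ D {h : ℕ → Carrier} → DegreeBelow D h → DegreeBelow (suc D) h
  degreeBelow-suc zero h≈0 k = trans (+-cong (h≈0 _) (-‿cong (h≈0 _))) (trans (+-congˡ -0#≈0#) (+-identityʳ _))
  degreeBelow-suc (suc D) dh = degreeBelow-suc D dh

  degreeBelow-shift : ∀ D {h : ℕ → Carrier} → DegreeBelow D h → DegreeBelow D (λ k → h (suc k))
  degreeBelow-shift zero h≈0 k = h≈0 (suc k)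
  degreeBelow-shift (suc D) dh = degreeBelow-shift D dh

  degreeBelow-const : ∀ D a → DegreeBelow (suc D) (λ _ → a)
  degreeBelow-const zero a k = -‿inverseʳ a
  degreeBelow-const (suc D) a = degreeBelow-suc (suc D) (degreeBelow-const D a)

  degreeBelow-index-* : ∀ D {h : ℕ → Carrier} → DegreeBelow D h → DegreeBelow (suc D) (λ k → ℕ→F k * h k)
  degreeBelow-index-* zero h≈0 = degreeBelow-suc 0 (λ k → trans (*-congˡ (h≈0 k)) (zeroʳ _))
  degreeBelow-index-* (suc D) {h} dh = degreeBelow-cong (suc D)
    (λ k → solve 3 (λ x a₁ a₀ → x :* (a₁ :- a₀) :+ a₁ := (con (+ 1) :+ x) :* a₁ :- x :* a₀) refl
             (ℕ→F k) (h (suc k)) (h k))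
    (degreeBelow-+ (suc D) (degreeBelow-index-* D dh) (degreeBelow-shift (suc D) dh))

  degreeBelow-eval : ∀ P → DegreeBelow (length P) (λ k → eval P (ℕ→F k))
  degreeBelow-eval [] k = refl
  degreeBelow-eval (a ∷ P) =
    degreeBelow-+ (suc (length P)) (degreeBelow-const (length P) a)
                  (degreeBelow-index-* (length P) (degreeBelow-eval P))

  ℤ→F-zero-* : ∀ {z} x → z ≡ + 0 → ℤ→F z * x ≈ 0#
  ℤ→F-zero-* x ≡.refl = zeroˡ x

  ℤ→F-[2+i]-3 : ∀ i → ℤ→F (+ suc (suc i) ℤ.- + 3) ≈ ℕ→F i - 1#
  ℤ→F-[2+i]-3 i = trans (ℤ→F-homo-⊖ (suc (suc i)) 3)
    (solve 1 (λ x → (con (+ 1) :+ (con (+ 1) :+ x)) :- (con (+ 1) :+ (con (+ 1) :+ (con (+ 1) :+ con (+ 0))))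
                  := x :- con (+ 1)) refl (ℕ→F i))

  -- Indices i, j with t_{i,j}(m + 1) ≠ 0 are all below 2m + 3.
  bound : ℕ → ℕ
  bound m = 3 ℕ.+ m ℕ.* 2

  bound-twice : ∀ m → suc (2 ℕ.* suc m) ≡ bound m
  bound-twice m = ≡.cong suc (ℕP.*-comm 2 (suc m))

  module Weights (s : Carrier) where

    weightTerm : ℕ → ℕ → ℕ → Carrier
    weightTerm m i j = ℤ→F (t (suc m) (+ i) (+ j)) * s ^ j

    -- The coefficient Σ_j t_{i,j}(m + 1) s^j of σ_i in -U_{m+1}.
    weight : ℕ → ℕ → Carrier
    weight m i = sumBelow (bound m) (weightTerm m i)

    weightTerm-high : ∀ m i j → 2 ℕ.+ m ℕ.* 2 ℕ.< i ℕ.+ j → weightTerm m i j ≈ 0#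
    weightTerm-high m i j i+j> = ℤ→F-zero-* _ (t-off-support m (+ i) (+ j) (inj₂ (inj₂ (+<+ i+j>))))

    weight-low : ∀ m i → i ℕ.< 2 ℕ.+ m → weight m i ≈ 0#
    weight-low m i i< = sumBelow-zero (bound m) (λ j _ →
      ℤ→F-zero-* _ (t-off-support m (+ i) (+ j) (inj₂ (inj₁ (+<+ i<)))))

    weight-high : ∀ m i → 2 ℕ.+ m ℕ.* 2 ℕ.< i → weight m i ≈ 0#
    weight-high m i i> = sumBelow-zero (bound m) (λ j _ →
      weightTerm-high m i j (ℕP.<-≤-trans i> (ℕP.m≤m+n i j)))

    weight-as-sumBelow : ∀ m i {B} → (2 ℕ.+ m ℕ.* 2) ∸ i ℕ.< B → sumBelow B (weightTerm m i) ≈ weight m i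
    weight-as-sumBelow m i {B} <B =
      trans (sumBelow-extend _ <B beyond) (sym (sumBelow-extend _ (s≤s (ℕP.m∸n≤m _ i)) beyond))
      where
      beyond : ∀ j → suc ((2 ℕ.+ m ℕ.* 2) ∸ i) ℕ.≤ j → weightTerm m i j ≈ 0#
      beyond j j> = weightTerm-high m i j (ℕP.≤-<-trans (ℕP.m≤n+m∸n _ i) (ℕP.+-monoʳ-< i j>))

    -- t_{2,j}(1) is 1, 0, 0 for j = 0, 1, 2.
    weight-0-2 : weight 0 2 ≈ 1#
    weight-0-2 = solve 1 (λ x →
        ((con (+ 0) :+ (con (+ 1) :+ con (+ 0)) :* con (+ 1)) :+ con (+ 0) :* (x :* con (+ 1)))
          :+ con (+ 0) :* (x :* (x :* con (+ 1)))
        := con (+ 1)) refl s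

    shiftedTerm : ℕ → ℕ → ℕ → Carrier
    shiftedTerm m i j = ℤ→F (t (suc m) (+ suc i) (+ j ℤ.- + 1)) * s ^ j

    weightTerm-suc : ∀ m i j → weightTerm (suc m) (2 ℕ.+ i) j ≈
      (ℕ→F i * weightTerm m (suc i) j + shiftedTerm m i j) + (ℕ→F i - 1#) * weightTerm m i j
    weightTerm-suc m i j = begin
      ℤ→F (a ℤ.* x ℤ.+ y ℤ.+ b ℤ.* z) * e
        ≈⟨ *-congʳ (trans (ℤ→F-homo-+ (a ℤ.* x ℤ.+ y) (b ℤ.* z))
                          (+-cong (trans (ℤ→F-homo-+ (a ℤ.* x) y) (+-congʳ (ℤ→F-homo-* a x))) (ℤ→F-homo-* b z))) ⟩
      (ℤ→F a * ℤ→F x + ℤ→F y + ℤ→F b * ℤ→F z) * e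
        ≈⟨ *-congʳ (+-congˡ (*-congʳ (ℤ→F-[2+i]-3 i))) ⟩
      (ℤ→F a * ℤ→F x + ℤ→F y + (ℕ→F i - 1#) * ℤ→F z) * e
        ≈⟨ solve 6 (λ A X Y B Z E → (A :* X :+ Y :+ B :* Z) :* E := (A :* (X :* E) :+ Y :* E) :+ B :* (Z :* E))
             refl (ℤ→F a) (ℤ→F x) (ℤ→F y) (ℕ→F i - 1#) (ℤ→F z) e ⟩
      (ℕ→F i * weightTerm m (suc i) j + shiftedTerm m i j) + (ℕ→F i - 1#) * weightTerm m i j ∎
      where
      a = + i
      b = + suc (suc i) ℤ.- + 3
      x = t (suc m) (+ suc i) (+ j)
      y = t (suc m) (+ suc i) (+ j ℤ.- + 1)
      z = t (suc m) (+ i) (+ j)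
      e = s ^ j

    shiftedTerm-sum : ∀ m i → sumBelow (bound (suc m)) (shiftedTerm m i) ≈ s * weight m (suc i)
    shiftedTerm-sum m i = begin
      sumBelow (bound (suc m)) (shiftedTerm m i)
        ≈⟨ sumBelow-suc (suc (bound m)) (shiftedTerm m i) ⟩
      shiftedTerm m i 0 + sumBelow (suc (bound m)) (λ k → shiftedTerm m i (suc k))
        ≈⟨ +-cong (ℤ→F-zero-* _ (t-off-support m (+ suc i) -[1+ 0 ] (inj₁ -<+)))
                  (sumBelow-cong (suc (bound m)) (λ k _ → x∙yz≈y∙xz _ s _)) ⟩
      0# + sumBelow (suc (bound m)) (λ k → s * weightTerm m (suc i) k)
        ≈⟨ trans (+-identityˡ _) (sumBelow-*ˡ (suc (bound m)) s _) ⟩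
      s * sumBelow (suc (bound m)) (weightTerm m (suc i))
        ≈⟨ *-congˡ (weight-as-sumBelow m (suc i) (s≤s (ℕP.≤-trans (ℕP.m∸n≤m _ (suc i)) (ℕP.n≤1+n _)))) ⟩
      s * weight m (suc i) ∎

    weight-suc : ∀ m i → weight (suc m) (2 ℕ.+ i) ≈ (ℕ→F i + s) * weight m (suc i) + (ℕ→F i - 1#) * weight m i
    weight-suc m i = begin
      weight (suc m) (2 ℕ.+ i)
        ≈⟨ sumBelow-cong B (λ j _ → weightTerm-suc m i j) ⟩
      sumBelow B (λ j → (ℕ→F i * weightTerm m (suc i) j + shiftedTerm m i j) + (ℕ→F i - 1#) * weightTerm m i j)
        ≈⟨ trans (sumBelow-+ B _ _) (+-congʳ (sumBelow-+ B _ _)) ⟩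
      (sumBelow B (λ j → ℕ→F i * weightTerm m (suc i) j) + sumBelow B (shiftedTerm m i))
        + sumBelow B (λ j → (ℕ→F i - 1#) * weightTerm m i j)
        ≈⟨ +-cong (+-cong (trans (sumBelow-*ˡ B _ _) (*-congˡ (weight-as-sumBelow m (suc i) (below (suc i)))))
                          (shiftedTerm-sum m i))
                  (trans (sumBelow-*ˡ B _ _) (*-congˡ (weight-as-sumBelow m i (below i)))) ⟩
      (ℕ→F i * weight m (suc i) + s * weight m (suc i)) + (ℕ→F i - 1#) * weight m i
        ≈⟨ +-congʳ (sym (distribʳ _ _ _)) ⟩
      (ℕ→F i + s) * weight m (suc i) + (ℕ→F i - 1#) * weight m i ∎
      where
      B = bound (suc m)
      below : ∀ i → (2 ℕ.+ m ℕ.* 2) ∸ i ℕ.< B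
      below i = s≤s (ℕP.≤-trans (ℕP.m∸n≤m _ i) (ℕP.≤-trans (ℕP.n≤1+n _) (ℕP.n≤1+n _)))

    weighted : ℕ → (ℕ → Carrier) → Carrier
    weighted m f = sumBelow (bound m) (λ i → f i * weight m i)

    -- The transpose of weight-suc.
    Φ : (ℕ → Carrier) → ℕ → Carrier
    Φ f k = ((ℕ→F k - 1#) + s) * f (suc k) + (ℕ→F k - 1#) * f (suc (suc k))

    weighted-cong : ∀ m {f g : ℕ → Carrier} → (∀ i → f i ≈ g i) → weighted m f ≈ weighted m g
    weighted-cong m f≈g = sumBelow-cong (bound m) (λ i _ → *-congʳ (f≈g i))

    weighted-local : ∀ m {f g : ℕ → Carrier} → (∀ i → 2 ℕ.+ m ℕ.≤ i → f i ≈ g i) → weighted m f ≈ weighted m g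
    weighted-local m {f} {g} f≈g = sumBelow-cong (bound m) (λ i _ → termwise i)
      where
      termwise : ∀ i → f i * weight m i ≈ g i * weight m i
      termwise i with 2 ℕ.+ m ℕP.≤? i
      ... | yes i≥ = *-congʳ (f≈g i i≥)
      ... | no  i≱ = trans (*-congˡ (weight-low m i (ℕP.≰⇒> i≱)))
                       (trans (zeroʳ _) (sym (trans (*-congˡ (weight-low m i (ℕP.≰⇒> i≱))) (zeroʳ _))))

    weighted-zero : ∀ f → weighted 0 f ≈ f 2
    weighted-zero f = begin
      ((0# + f 0 * weight 0 0) + f 1 * weight 0 1) + f 2 * weight 0 2
        ≈⟨ +-cong (+-cong (+-congˡ (*-congˡ (weight-low 0 0 (s≤s z≤n))))
                          (*-congˡ (weight-low 0 1 (s≤s (s≤s z≤n)))))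
                  (*-congˡ weight-0-2) ⟩
      ((0# + f 0 * 0#) + f 1 * 0#) + f 2 * 1#
        ≈⟨ solve 3 (λ a b d → ((con (+ 0) :+ a :* con (+ 0)) :+ b :* con (+ 0)) :+ d :* con (+ 1) := d)
                   refl (f 0) (f 1) (f 2) ⟩
      f 2 ∎

    weighted-suc : ∀ m f → weighted (suc m) f ≈ weighted m (Φ f)
    weighted-suc m f = begin
      weighted (suc m) f
        ≈⟨ trans (sumBelow-suc (suc N) g) (+-congˡ (sumBelow-suc N (λ k → g (suc k)))) ⟩
      g 0 + (g 1 + sumBelow N (λ k → g (2 ℕ.+ k)))
        ≈⟨ +-cong (g-low 0 (s≤s z≤n)) (+-cong (g-low 1 (s≤s (s≤s z≤n))) (sumBelow-cong N (λ k _ → g-split k))) ⟩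
      0# + (0# + sumBelow N (λ k → A (suc k) + B k))
        ≈⟨ trans (+-identityˡ _) (+-identityˡ _) ⟩
      sumBelow N (λ k → A (suc k) + B k)
        ≈⟨ trans (sumBelow-+ N _ _)
                 (+-congʳ (sumBelow-reindex-suc N A (A-zero 0 (inj₁ (s≤s z≤n))) (A-zero N (inj₂ (ℕP.n<1+n _))))) ⟩
      sumBelow N A + sumBelow N B
        ≈⟨ trans (sym (sumBelow-+ N _ _)) (sumBelow-cong N (λ k _ → sym (distribʳ _ _ _))) ⟩
      weighted m (Φ f) ∎
      where
      N = bound m
      g : ℕ → Carrier
      g i = f i * weight (suc m) i
      A B : ℕ → Carrier
      A k = (((ℕ→F k - 1#) + s) * f (suc k)) * weight m k
      B k = ((ℕ→F k - 1#) * f (suc (suc k))) * weight m k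
      g-low : ∀ i → i ℕ.< 3 ℕ.+ m → g i ≈ 0#
      g-low i i< = trans (*-congˡ (weight-low (suc m) i i<)) (zeroʳ _)
      A-zero : ∀ k → k ℕ.< 2 ℕ.+ m ⊎ 2 ℕ.+ m ℕ.* 2 ℕ.< k → A k ≈ 0#
      A-zero k (inj₁ k<) = trans (*-congˡ (weight-low m k k<)) (zeroʳ _)
      A-zero k (inj₂ k>) = trans (*-congˡ (weight-high m k k>)) (zeroʳ _)
      g-split : ∀ k → g (2 ℕ.+ k) ≈ A (suc k) + B k
      g-split k = trans (*-congˡ (weight-suc m k))
        (solve 5 (λ x s′ f₂ w₁ w₀ → f₂ :* ((x :+ s′) :* w₁ :+ (x :- con (+ 1)) :* w₀)
                    := (((con (+ 1) :+ x) :- con (+ 1)) :+ s′) :* f₂ :* w₁ :+ (x :- con (+ 1)) :* f₂ :* w₀)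
           refl (ℕ→F k) s (f (suc (suc k))) (weight m (suc k)) (weight m k))

    alternating : (ℕ → Carrier) → ℕ → Carrier
    alternating h k = (- 1#) ^ k * h k

    Ψ : (ℕ → Carrier) → ℕ → Carrier
    Ψ h k = (ℕ→F k - 1#) * (h (suc (suc k)) - h (suc k)) - s * h (suc k)

    Φ-alternating : ∀ h k → Φ (alternating h) k ≈ alternating (Ψ h) k
    Φ-alternating h k = solve 5 (λ x s′ e h₁ h₂ →
        ((x :- con (+ 1)) :+ s′) :* ((:- con (+ 1) :* e) :* h₁)
          :+ (x :- con (+ 1)) :* ((:- con (+ 1) :* (:- con (+ 1) :* e)) :* h₂)
        := e :* ((x :- con (+ 1)) :* (h₂ :- h₁) :- s′ :* h₁))
      refl (ℕ→F k) s ((- 1#) ^ k) (h (suc k)) (h (suc (suc k)))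

    weighted-alternating : ∀ m h → weighted m (alternating h) ≈ iterate Ψ h m 2
    weighted-alternating zero h = trans (weighted-zero (alternating h))
      (solve 1 (λ x → (:- con (+ 1) :* (:- con (+ 1) :* con (+ 1))) :* x := x) refl (h 2))
    weighted-alternating (suc m) h =
      trans (weighted-suc m (alternating h))
            (trans (weighted-cong m (Φ-alternating h)) (weighted-alternating m (Ψ h)))

    Ψ-cong : ∀ {h g : ℕ → Carrier} → (∀ k → h k ≈ g k) → ∀ k → Ψ h k ≈ Ψ g k
    Ψ-cong h≈g k = +-cong (*-congˡ (+-cong (h≈g _) (-‿cong (h≈g _)))) (-‿cong (*-congˡ (h≈g _)))

    Ψ-+ : ∀ (h g : ℕ → Carrier) k → Ψ (λ i → h i + g i) k ≈ Ψ h k + Ψ g k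
    Ψ-+ h g k = solve 6 (λ x s′ a₁ a₂ b₁ b₂ →
        (x :- con (+ 1)) :* ((a₂ :+ b₂) :- (a₁ :+ b₁)) :- s′ :* (a₁ :+ b₁)
        := ((x :- con (+ 1)) :* (a₂ :- a₁) :- s′ :* a₁) :+ ((x :- con (+ 1)) :* (b₂ :- b₁) :- s′ :* b₁))
      refl (ℕ→F k) s (h (suc k)) (h (suc (suc k))) (g (suc k)) (g (suc (suc k)))

    Ψ-*ˡ : ∀ d (h : ℕ → Carrier) k → Ψ (λ i → d * h i) k ≈ d * Ψ h k
    Ψ-*ˡ d h k = solve 5 (λ x s′ c a₁ a₂ →
        (x :- con (+ 1)) :* (c :* a₂ :- c :* a₁) :- s′ :* (c :* a₁)
        := c :* ((x :- con (+ 1)) :* (a₂ :- a₁) :- s′ :* a₁))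
      refl (ℕ→F k) s d (h (suc k)) (h (suc (suc k)))

    iterateΨ-cong : ∀ m {h g : ℕ → Carrier} → (∀ k → h k ≈ g k) → ∀ k → iterate Ψ h m k ≈ iterate Ψ g m k
    iterateΨ-cong zero h≈g = h≈g
    iterateΨ-cong (suc m) h≈g = iterateΨ-cong m (Ψ-cong h≈g)

    iterateΨ-+ : ∀ m (h g : ℕ → Carrier) k →
      iterate Ψ (λ i → h i + g i) m k ≈ iterate Ψ h m k + iterate Ψ g m k
    iterateΨ-+ zero h g k = refl
    iterateΨ-+ (suc m) h g k = trans (iterateΨ-cong m (Ψ-+ h g) k) (iterateΨ-+ m (Ψ h) (Ψ g) k)

    iterateΨ-*ˡ : ∀ m d (h : ℕ → Carrier) k → iterate Ψ (λ i → d * h i) m k ≈ d * iterate Ψ h m k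
    iterateΨ-*ˡ zero d h k = refl
    iterateΨ-*ˡ (suc m) d h k = trans (iterateΨ-cong m (Ψ-*ˡ d h) k) (iterateΨ-*ˡ m d (Ψ h) k)

    Ψ-lowers-degree : ∀ D {h : ℕ → Carrier} → DegreeBelow (suc D) h →
      DegreeBelow D (λ k → Ψ h k + (- (ℕ→F D - s)) * h k)
    Ψ-lowers-degree zero {h} Δh≈0 k = begin
      Ψ h k + (- (0# - s)) * h k
        ≈⟨ solve 5 (λ x s′ h₀ h₁ h₂ →
             (x :- con (+ 1)) :* (h₂ :- h₁) :- s′ :* h₁ :+ (:- (con (+ 0) :- s′)) :* h₀
             := (x :- con (+ 1)) :* (h₂ :- h₁) :- s′ :* (h₁ :- h₀))
             refl (ℕ→F k) s (h k) (h (suc k)) (h (suc (suc k))) ⟩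
      (ℕ→F k - 1#) * Δ h (suc k) - s * Δ h k
        ≈⟨ +-cong (*-congˡ (Δh≈0 (suc k))) (-‿cong (*-congˡ (Δh≈0 k))) ⟩
      (ℕ→F k - 1#) * 0# - s * 0#
        ≈⟨ solve 2 (λ x s′ → x :* con (+ 0) :- s′ :* con (+ 0) := con (+ 0)) refl (ℕ→F k - 1#) s ⟩
      0# ∎
    Ψ-lowers-degree (suc D) {h} dh = degreeBelow-cong D Δ-commute
      (degreeBelow-+ D (Ψ-lowers-degree D dh) (degreeBelow-+ D (degreeBelow-shift D dh) dh))
      where
      -- Δ (Ψ h) k = Ψ (Δ h) k + Δ h (k + 2).
      Δ-commute : ∀ k → (Ψ (Δ h) k + (- (ℕ→F D - s)) * Δ h k) + (Δ (Δ h) (suc k) + Δ (Δ h) k)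
                      ≈ Δ (λ i → Ψ h i + (- (ℕ→F (suc D) - s)) * h i) k
      Δ-commute k = solve 7 (λ x y s′ h₀ h₁ h₂ h₃ →
          ((x :- con (+ 1)) :* ((h₃ :- h₂) :- (h₂ :- h₁)) :- s′ :* (h₂ :- h₁) :+ (:- (y :- s′)) :* (h₁ :- h₀))
            :+ (((h₃ :- h₂) :- (h₂ :- h₁)) :+ ((h₂ :- h₁) :- (h₁ :- h₀)))
          := (((con (+ 1) :+ x) :- con (+ 1)) :* (h₃ :- h₂) :- s′ :* h₂ :+ (:- ((con (+ 1) :+ y) :- s′)) :* h₁)
             :- ((x :- con (+ 1)) :* (h₂ :- h₁) :- s′ :* h₁ :+ (:- ((con (+ 1) :+ y) :- s′)) :* h₀))
        refl (ℕ→F k) (ℕ→F D) s (h k) (h (suc k)) (h (suc (suc k))) (h (suc (suc (suc k))))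

    iterateΨ-annihilated : ∀ D {h : ℕ → Carrier} → DegreeBelow D h →
      EventuallyAnnihilated (λ m → iterate Ψ h m 2)
    iterateΨ-annihilated zero {h} h≈0 =
      annihilated-eventually-cong 0 (λ m _ → sym (iterateΨ-zero m)) zero-annihilated
      where
      iterateΨ-zero : ∀ m → iterate Ψ h m 2 ≈ 0#
      iterateΨ-zero m = begin
        iterate Ψ h m 2                  ≈⟨ iterateΨ-cong m (λ i → trans (h≈0 i) (sym (zeroˡ (h i)))) 2 ⟩
        iterate Ψ (λ i → 0# * h i) m 2  ≈⟨ iterateΨ-*ˡ m 0# h 2 ⟩
        0# * iterate Ψ h m 2             ≈⟨ zeroˡ _ ⟩
        0#                               ∎
    iterateΨ-annihilated (suc D) {h} dh = annihilated-step d
      (annihilated-eventually-cong 0 (λ m _ → step m) (iterateΨ-annihilated D (Ψ-lowers-degree D dh)))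
      where
      d = - (ℕ→F D - s)
      step : ∀ m → iterate Ψ (λ k → Ψ h k + d * h k) m 2 ≈ iterate Ψ h (suc m) 2 + d * iterate Ψ h m 2
      step m = trans (iterateΨ-+ m (Ψ h) (λ k → d * h k) 2) (+-congˡ (iterateΨ-*ˡ m d h 2))

  module _ (σ : ℕ → Carrier) where
    open Weights (- σ 1)

    U-suc : ∀ m → U σ (suc m) ≈ - weighted m σ
    U-suc m = -‿cong (begin
      sumFromTo (suc n) (2 ℕ.* n) (λ i → σ i * sumBelow (suc (2 ℕ.* n ∸ i)) (weightTerm m i))
        ≈⟨ sumBelow-cong (suc (2 ℕ.* n) ∸ suc n) (λ k _ → *-congˡ (weight-as-sumBelow m (suc n ℕ.+ k) (inner k))) ⟩
      sumFromTo (suc n) (2 ℕ.* n) (λ i → σ i * weight m i)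
        ≈⟨ sumFromTo-as-sumBelow (2 ℕ.* n) _ (s≤s (ℕP.m≤m+n n _))
             (λ i i< → trans (*-congˡ (weight-low m i i<)) (zeroʳ _)) ⟩
      sumBelow (suc (2 ℕ.* n)) (λ i → σ i * weight m i)
        ≡⟨ ≡.cong (λ b → sumBelow b (λ i → σ i * weight m i)) (bound-twice m) ⟩
      weighted m σ ∎)
      where
      n = suc m
      inner : ∀ k → (2 ℕ.+ m ℕ.* 2) ∸ (suc n ℕ.+ k) ℕ.< suc (2 ℕ.* n ∸ (suc n ℕ.+ k))
      inner k = s≤s (ℕP.≤-reflexive (≡.cong (_∸ (suc n ℕ.+ k)) (ℕP.*-comm (suc m) 2)))

    U-eventually : ∀ A (h : ℕ → Carrier) → (∀ i → 1 ℕ.≤ i → A ℕ.≤ i → σ i ≈ alternating h i) →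
      ∀ m → A ℕ.≤ m → U σ (suc m) ≈ - iterate Ψ h m 2
    U-eventually A h σ≈ m A≤m =
      trans (U-suc m) (-‿cong (trans (weighted-local m σ≈′) (weighted-alternating m h)))
      where
      σ≈′ : ∀ i → 2 ℕ.+ m ℕ.≤ i → σ i ≈ alternating h i
      σ≈′ i i≥ = σ≈ i (ℕP.≤-trans (s≤s z≤n) i≥) (ℕP.≤-trans A≤m (ℕP.≤-trans (ℕP.m≤n+m m 2) i≥))

proposition8p1 : ∀ {c ℓ : Level} (F : Field c ℓ) → FieldOps.CharacteristicZero F → FieldOps.AlgebraicallyClosed F →
    (σ : ℕ → Field.Carrier F) → FieldOps.EventuallyAltPoly F σ → FieldOps.IsRational F (FieldOps.U F σ)
proposition8p1 F _ _ σ (A , P , σ≈) =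
  annihilated⇒rational (annihilated-tail {U σ}
    (annihilated-eventually-cong A U≈ (annihilated-*ˡ (- 1#) Ψᵐp-annihilated)))
  where
  open Field F
  open FieldOps F
  open Rationality F
  open Weights (- σ 1)
  open RingProperties ring using (-1*x≈-x)

  p : ℕ → Carrier
  p k = eval P (ℕ→F k)

  Ψᵐp-annihilated : EventuallyAnnihilated (λ m → iterate Ψ p m 2)
  Ψᵐp-annihilated = iterateΨ-annihilated (length P) (degreeBelow-eval P)

  U≈ : ∀ m → A ℕ.≤ m → - 1# * iterate Ψ p m 2 ≈ U σ (suc m)
  U≈ m A≤m = trans (-1*x≈-x _) (sym (U-eventually σ A p σ≈ m A≤m))
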